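{- The only points $(X,Y)$ with $X\in\mathbb{Q}$ and $Y\in\mathbb{Q}(\sqrt{2})$ on the curve $$\mathcal{C}_{\pi/4,\pi/3}:\quad X^4-(1+\sqrt{2})X^3+(2+\sqrt{2})X^2-(1+\sqrt{2})X+1=Y^2$$ are $(X,Y)=(0,\pm 1)$. Consequently there are no positive integers $x,y$ for which both $\sqrt{x^2-\sqrt{2}\,xy+y^2}$ and $\sqrt{x^2-xy+y^2}$ lie in $\mathbb{Q}(\sqrt{2})$.
   Context: The curve arises from the equations $x^2-2\cos(\pi/4)xy+y^2=z_1^2$ and $x^2-2\cos(\pi/3)xy+y^2=z_2^2$ (law of cosines for triangles with two integer sides $x,y$ enclosing angles $\pi/4$ and $\pi/3$, with opposite sides $z_1,z_2\in\mathbb{Q}(\sqrt2)$) by multiplying them and setting $X=x/y$, $Y=z_1z_2/y^2$. -}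

module Defs where

open import Data.Rational using (ℚ; 0ℚ; 1ℚ) renaming (_+_ to _+ℚ_; _*_ to _*ℚ_; -_ to -ℚ_)
open import Data.Integer using (ℤ)
open import Data.Rational using (_/_)

-- Since ℚ in the standard library is normalised, propositional equality on this record
-- is the equality of ℚ(√2) (1, √2 form a ℚ-basis).
record ℚ√2 : Set where
  constructor _+_√2
  field
    re : ℚ
    ir : ℚ
open ℚ√2 public

infixl 6 _⊕_ _⊖_
infixl 7 _⊛_

_⊕_ : ℚ√2 → ℚ√2 → ℚ√2
(a + b √2) ⊕ (c + d √2) = (a +ℚ c) + (b +ℚ d) √2

⊝_ : ℚ√2 → ℚ√2
⊝ (a + b √2) = (-ℚ a) + (-ℚ b) √2

_⊖_ : ℚ√2 → ℚ√2 → ℚ√2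
x ⊖ y = x ⊕ (⊝ y)

-- (a + b√2)(c + d√2) = (ac + 2bd) + (ad + bc)√2
_⊛_ : ℚ√2 → ℚ√2 → ℚ√2
(a + b √2) ⊛ (c + d √2) =
  ((a *ℚ c) +ℚ ((b *ℚ d) +ℚ (b *ℚ d))) + ((a *ℚ d) +ℚ (b *ℚ c)) √2

ι : ℚ → ℚ√2
ι q = q + 0ℚ √2

one : ℚ√2
one = ι 1ℚ

two : ℚ√2
two = one ⊕ one

√2 : ℚ√2
√2 = 0ℚ + 1ℚ √2

curveLHS : ℚ√2 → ℚ√2
curveLHS X =
  (X ⊛ X ⊛ X ⊛ X)
  ⊖ ((one ⊕ √2) ⊛ (X ⊛ X ⊛ X))
  ⊕ ((two ⊕ √2) ⊛ (X ⊛ X))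
  ⊖ ((one ⊕ √2) ⊛ X)
  ⊕ one

OnCurve : ℚ → ℚ√2 → Set
OnCurve X Y = curveLHS (ι X) ≡ Y ⊛ Y
  where open import Relation.Binary.PropositionalEquality using (_≡_)

ιℤ : ℤ → ℚ√2
ιℤ n = ι (n / 1)

HasSqrtIn : ℚ√2 → Set
HasSqrtIn r = Σ ℚ√2 (λ z → z ⊛ z ≡ r)
  where open import Data.Product using (Σ)
        open import Relation.Binary.PropositionalEquality using (_≡_)

{-# OPTIONS --safe #-}
-- Norms from ℚ(√2) to ℚ reduce everything to Fermat's theorem that x⁴ + y⁴ = z² has no
-- solution with xy ≠ 0, proved by descent through primitive Pythagorean triples.
-- For rational X the left side of the curve factors as (X² − X + 1)(X² − √2 X + 1), of norm
-- (X² − X + 1)² (X⁴ + 1); as X² − X + 1 ≠ 0, a point (X , Y) makes X⁴ + 1 a rational square,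
-- which forces X = 0 and then Y² = 1. Likewise the norm of x² − √2 xy + y² is x⁴ + y⁴.
module Submission where

open import Defs
open import Data.Rational using (ℚ; 0ℚ; _/_)
open import Data.Integer using (ℤ; +_; _>_)
open import Data.Product using (_×_; _,_)
open import Data.Sum using (_⊎_)
open import Relation.Binary.PropositionalEquality using (_≡_; refl)
open import Relation.Nullary using (¬_)

module NatSquares where
  open import Data.Nat
  open import Data.Nat.Properties
  open import Data.Nat.Divisibility
  open import Data.Nat.Coprimality using (Coprime; coprime-divisor) renaming (sym to coprime-sym)
  open import Data.Nat.Primality using (Prime; euclidsLemma; prime⇒nonZero; prime⇒nonTrivial)
  open import Data.Nat.Primality.Factorisation using (factorise)
  open import Data.Nat.Induction using (<-rec)
  open import Data.Nat.Tactic.RingSolver using (solve)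
  open import Data.List using (_∷_; [])
  open import Data.List.Relation.Unary.All using () renaming (_∷_ to _∷ᴬ_)
  open import Data.Nat.ListAction using (product)
  open import Data.Product using (∃-syntax; _×_; _,_)
  open import Data.Sum using (inj₁; inj₂)
  open import Relation.Binary.PropositionalEquality
  open import Relation.Binary.Definitions using (tri<; tri≈; tri>)
  open import Relation.Nullary using (contradiction)
  open ≡-Reasoning

  coprime-∣ˡ : ∀ {m n d} → Coprime m n → d ∣ m → Coprime d n
  coprime-∣ˡ c d∣m (e∣d , e∣n) = c (∣-trans e∣d d∣m , e∣n)

  coprime-∣ʳ : ∀ {m n d} → Coprime m n → d ∣ n → Coprime m d
  coprime-∣ʳ c d∣n = coprime-sym (coprime-∣ˡ (coprime-sym c) d∣n)

  coprime-*ʳ : ∀ {m n o} → Coprime m n → Coprime m o → Coprime m (n * o)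
  coprime-*ʳ cmn cmo (d∣m , d∣no) = cmo (d∣m , coprime-divisor (coprime-∣ˡ cmn d∣m) d∣no)

  coprime-*²ʳ : ∀ {m n} → Coprime m n → Coprime m (n * n)
  coprime-*²ʳ c = coprime-*ʳ c c

  coprime-*² : ∀ {m n} → Coprime m n → Coprime (m * m) (n * n)
  coprime-*² c = coprime-sym (coprime-*²ʳ (coprime-sym (coprime-*²ʳ c)))

  coprime-*²⇒coprime : ∀ {m n} → Coprime (m * m) (n * n) → Coprime m n
  coprime-*²⇒coprime {m} {n} c = coprime-∣ˡ (coprime-∣ʳ c (m∣m*n n)) (m∣m*n m)

  coprime-+*² : ∀ {r s} → Coprime r s → Coprime r (r * r + s * s)
  coprime-+*² {r} crs (d∣r , d∣rr+ss) =
    coprime-*²ʳ crs (d∣r , ∣m+n∣m⇒∣n d∣rr+ss (∣m⇒∣m*n r d∣r))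

  *²-injective : ∀ {m n} → m * m ≡ n * n → m ≡ n
  *²-injective {m} {n} eq with <-cmp m n
  ... | tri≈ _ m≡n _ = m≡n
  ... | tri< m<n _ _ = contradiction eq (<⇒≢ (*-mono-< m<n m<n))
  ... | tri> _ _ n<m = contradiction (sym eq) (<⇒≢ (*-mono-< n<m n<m))

  *²≡0⇒≡0 : ∀ {n} → n * n ≡ 0 → n ≡ 0
  *²≡0⇒≡0 {n} nn≡0 with m*n≡0⇒m≡0∨n≡0 n nn≡0
  ... | inj₁ n≡0 = n≡0
  ... | inj₂ n≡0 = n≡0

  n≤n*n : ∀ n → n ≤ n * n
  n≤n*n zero = z≤n
  n≤n*n n@(suc _) = m≤m*n n n

  *²-cancel-≤ : ∀ {a c} → a * a ≤ c * c → a ≤ c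
  *²-cancel-≤ aa≤cc = ≮⇒≥ (λ c<a → <⇒≱ (*-mono-< c<a c<a) aa≤cc)

  prime-divisor : ∀ n → 2 ≤ n → ∃[ p ] Prime p × p ∣ n
  prime-divisor n@(suc _) 2≤n with factorise n
  ... | record { factors = [] ; isFactorisation = eq } = contradiction (sym eq) (<⇒≢ 2≤n)
  ... | record { factors = p ∷ ps ; isFactorisation = eq ; factorsPrime = p-prime ∷ᴬ _ } =
    p , p-prime , divides (product ps) (trans eq (*-comm p (product ps)))

  prime-∣-square : ∀ {p k} → Prime p → p ∣ k * k → p ∣ k
  prime-∣-square {k = k} p-prime p∣kk with euclidsLemma k k p-prime p∣kk
  ... | inj₁ p∣k = p∣k
  ... | inj₂ p∣k = p∣k

  m*p*n≡[k*p]²⇒m*n≡p*k² : ∀ m n k p .{{_ : NonZero p}} →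
                          m * p * n ≡ k * p * (k * p) → m * n ≡ p * (k * k)
  m*p*n≡[k*p]²⇒m*n≡p*k² m n k p eq = *-cancelʳ-≡ (m * n) (p * (k * k)) p (begin
    m * n * p         ≡⟨ solve (m ∷ n ∷ p ∷ []) ⟩
    m * p * n         ≡⟨ eq ⟩
    k * p * (k * p)   ≡⟨ solve (k ∷ p ∷ []) ⟩
    p * (k * k) * p   ∎)

  -- p ∣ k, and since p ∤ n the cofactor m / p is still divisible by p.
  remove-prime² : ∀ {m n k p} → Prime p → p ∣ m → Coprime m n → m * n ≡ k * k →
                  ∃[ m′ ] ∃[ k′ ] m ≡ m′ * (p * p) × m′ * n ≡ k′ * k′
  remove-prime² {n = n} {k} {p} p-prime p∣m@(divides mq refl) c mn≡kk
    with prime-∣-square {k = k} p-prime (subst (p ∣_) mn≡kk (∣m⇒∣m*n n p∣m))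
  ... | divides kq refl with m*p*n≡[k*p]²⇒m*n≡p*k² mq n kq p {{prime⇒nonZero p-prime}} mn≡kk
  ... | mqn≡pkk
    with coprime-divisor (coprime-∣ˡ c (n∣m*n mq))
                         (subst (p ∣_) (sym (trans (*-comm n mq) mqn≡pkk)) (m∣m*n (kq * kq)))
  ... | divides m′ refl = m′ , kq , *-assoc m′ p p ,
    *-cancelˡ-≡ (m′ * n) (kq * kq) p {{prime⇒nonZero p-prime}} (begin
      p * (m′ * n)  ≡⟨ solve (p ∷ m′ ∷ n ∷ []) ⟩
      m′ * p * n    ≡⟨ mqn≡pkk ⟩
      p * (kq * kq) ∎)

  coprime-factor-square : ∀ {m n k} → Coprime m n → m * n ≡ k * k → ∃[ a ] m ≡ a * a
  coprime-factor-square {m} {n} {k} = <-rec Goal step m {n} {k}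
    where
    Goal : ℕ → Set
    Goal m = ∀ {n k} → Coprime m n → m * n ≡ k * k → ∃[ a ] m ≡ a * a
    step : ∀ m → (∀ {m′} → m′ < m → Goal m′) → Goal m
    step 0 _ _ _ = 0 , refl
    step 1 _ _ _ = 1 , refl
    step m@(suc (suc _)) rec {n} {k} c mn≡kk with prime-divisor m (s≤s (s≤s z≤n))
    ... | p , p-prime , p∣m with remove-prime² {k = k} p-prime p∣m c mn≡kk
    ... | m′ , k′ , m≡m′pp , m′n≡k′k′ with rec m′<m {k = k′} (coprime-∣ˡ c m′∣m) m′n≡k′k′
      where
      m′∣m : m′ ∣ m
      m′∣m = divides (p * p) (trans m≡m′pp (*-comm m′ (p * p)))
      m′<m : m′ < m
      m′<m = quotient-< (divides m′ m≡m′pp) {{n>1⇒nonTrivial (<-≤-trans p>1 (m≤m*n p p {{p≢0}}))}}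
        where
        p>1 : 1 < p
        p>1 = nonTrivial⇒n>1 p {{prime⇒nonTrivial p-prime}}
        p≢0 : NonZero p
        p≢0 = prime⇒nonZero p-prime
    ... | a , refl = a * p , trans m≡m′pp (solve (a ∷ p ∷ []))

module FermatQuartic where
  open import Data.Nat
  open import Data.Nat.Properties
  open import Data.Nat.Divisibility
  open import Data.Nat.Coprimality using (Coprime) renaming (sym to coprime-sym)
  open import Data.Nat.Primality using (prime[2])
  open import Data.Nat.Induction using (<-rec)
  open import Data.Nat.Tactic.RingSolver using (solve)
  open import Data.List using (_∷_; [])
  open import Data.Product using (∃-syntax; _×_; _,_)
  open import Data.Sum using (_⊎_; inj₁; inj₂)
  open import Relation.Binary.PropositionalEquality
  open import Relation.Nullary using (¬_; contradiction; yes; no)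
  open import Function using (_∘_)
  open import Relation.Nullary.Decidable using (decidable-stable)
  open ≡-Reasoning
  open NatSquares

  even⊎odd : ∀ n → (∃[ k ] n ≡ 2 * k) ⊎ (∃[ k ] n ≡ 1 + 2 * k)
  even⊎odd 0 = inj₁ (0 , refl)
  even⊎odd 1 = inj₂ (0 , refl)
  even⊎odd (suc (suc n)) with even⊎odd n
  ... | inj₁ (k , refl) = inj₁ (1 + k , solve (k ∷ []))
  ... | inj₂ (k , refl) = inj₂ (1 + k , solve (k ∷ []))

  ¬2∣⇒odd : ∀ {n} → ¬ 2 ∣ n → ∃[ k ] n ≡ 1 + 2 * k
  ¬2∣⇒odd {n} 2∤n with even⊎odd n
  ... | inj₁ (k , refl) = contradiction (divides k (*-comm 2 k)) 2∤n
  ... | inj₂ odd = odd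

  2∣²⇒2∣ : ∀ {n} → 2 ∣ n * n → 2 ∣ n
  2∣²⇒2∣ = prime-∣-square prime[2]

  square≢2*odd : ∀ c s → c * c ≢ 2 * (1 + 2 * s)
  square≢2*odd c s eq with even⊎odd c
  ... | inj₁ (k , refl) = even≢odd (k * k) s (*-cancelˡ-≡ (2 * (k * k)) (1 + 2 * s) 2 (begin
    2 * (2 * (k * k)) ≡⟨ solve (k ∷ []) ⟩
    2 * k * (2 * k)   ≡⟨ eq ⟩
    2 * (1 + 2 * s)   ∎))
  ... | inj₂ (k , refl) = even≢odd (1 + 2 * s) (2 * (k * k + k)) (begin
    2 * (1 + 2 * s)            ≡⟨ eq ⟨
    (1 + 2 * k) * (1 + 2 * k)  ≡⟨ solve (k ∷ []) ⟩
    1 + 2 * (2 * (k * k + k))  ∎)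

  odd²+odd²≢² : ∀ {a b c} → ¬ 2 ∣ a → ¬ 2 ∣ b → a * a + b * b ≢ c * c
  odd²+odd²≢² {c = c} 2∤a 2∤b with ¬2∣⇒odd 2∤a | ¬2∣⇒odd 2∤b
  ... | i , refl | j , refl = λ eq → square≢2*odd c (i * i + i + j * j + j) (begin
      c * c                                                  ≡⟨ eq ⟨
      (1 + 2 * i) * (1 + 2 * i) + (1 + 2 * j) * (1 + 2 * j)  ≡⟨ solve (i ∷ j ∷ []) ⟩
      2 * (1 + 2 * (i * i + i + j * j + j))                  ∎)

  coprime⇒¬both-even : ∀ {a b} → Coprime a b → 2 ∣ b → ¬ 2 ∣ a
  coprime⇒¬both-even cab 2∣b 2∣a with cab (2∣a , 2∣b)
  ... | ()

  -- For odd a the hypotenuse c is odd as well, so c − a is even.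
  pythagorean-gap : ∀ {a β c} → ¬ 2 ∣ a → a * a + β * 2 * (β * 2) ≡ c * c →
                    ∃[ u ] c ≡ a + 2 * u × u * (a + u) ≡ β * β
  pythagorean-gap {a} {β} {c} 2∤a eq with ¬2∣⇒odd 2∤a | ¬2∣⇒odd 2∤c
    where
    2∤c : ¬ 2 ∣ c
    2∤c 2∣c = 2∤a (2∣²⇒2∣ (∣m+n∣m⇒∣n
      (subst (2 ∣_) (trans (sym eq) (+-comm (a * a) _)) (∣m⇒∣m*n c 2∣c))
      (∣n⇒∣m*n (β * 2) (n∣m*n β))))
  ... | i , refl | k , refl with m≤n⇒∃[o]m+o≡n {i} {k} i≤k
    where
    i≤k : i ≤ k
    i≤k = *-cancelˡ-≤ 2 (s≤s⁻¹ (*²-cancel-≤ (subst (a * a ≤_) eq (m≤m+n (a * a) _))))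
  ... | u , refl =
    u , solve (i ∷ u ∷ []) , sym (*-cancelˡ-≡ (β * β) (u * (a + u)) 4 (+-cancelˡ-≡ (a * a) _ _ (begin
    a * a + 4 * (β * β)                   ≡⟨ solve (i ∷ β ∷ []) ⟩
    a * a + β * 2 * (β * 2)               ≡⟨ eq ⟩
    (1 + 2 * (i + u)) * (1 + 2 * (i + u)) ≡⟨ solve (i ∷ u ∷ []) ⟩
    a * a + 4 * (u * (a + u))             ∎)))

  gap-coprime : ∀ {a β u} → Coprime a (β * 2) → u * (a + u) ≡ β * β → Coprime u (a + u)
  gap-coprime {a} {β} {u} cab eq {d} (d∣u , d∣a+u) = coprime-*²ʳ cab (d∣a , d∣bb)
    where
    d∣a : d ∣ a
    d∣a = ∣m+n∣m⇒∣n (subst (d ∣_) (+-comm a u) d∣a+u) d∣u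
    d∣bb : d ∣ β * 2 * (β * 2)
    d∣bb = subst (d ∣_) (solve (β ∷ [])) (∣m⇒∣m*n 4 (subst (d ∣_) eq (∣m⇒∣m*n (a + u) d∣u)))

  pythagorean-parametrisation : ∀ {a b c} → Coprime a b → 2 ∣ b → a * a + b * b ≡ c * c →
    ∃[ m ] ∃[ n ] Coprime m n × a + n * n ≡ m * m × b ≡ 2 * (m * n) × c ≡ m * m + n * n
  pythagorean-parametrisation {a} {c = c} cab 2∣b@(divides β refl) eq
    with pythagorean-gap {β = β} {c} (coprime⇒¬both-even cab 2∣b) eq
  ... | u , refl , u[a+u]≡ββ
    with coprime-factor-square {u} {k = β} (gap-coprime {β = β} {u} cab u[a+u]≡ββ) u[a+u]≡ββ
       | coprime-factor-square {a + u} {k = β} (coprime-sym (gap-coprime {β = β} {u} cab u[a+u]≡ββ))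
                                      (trans (*-comm (a + u) u) u[a+u]≡ββ)
  ... | n , refl | m , a+nn≡mm =
    m , n , coprime-sym (coprime-*²⇒coprime c[nn,mm]) , a+nn≡mm ,
    trans (cong (_* 2) β≡mn) (*-comm (m * n) 2) , (begin
      a + 2 * (n * n)   ≡⟨ solve (a ∷ n ∷ []) ⟩
      a + n * n + n * n ≡⟨ cong (_+ n * n) a+nn≡mm ⟩
      m * m + n * n     ∎)
    where
    c[nn,mm] : Coprime (n * n) (m * m)
    c[nn,mm] = subst (Coprime (n * n)) a+nn≡mm (gap-coprime {β = β} {n * n} cab u[a+u]≡ββ)
    β≡mn : β ≡ m * n
    β≡mn = *²-injective (begin
      β * β                   ≡⟨ u[a+u]≡ββ ⟨
      n * n * (a + n * n)     ≡⟨ cong (n * n *_) a+nn≡mm ⟩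
      n * n * (m * m)         ≡⟨ solve (m ∷ n ∷ []) ⟩
      m * n * (m * n)         ∎)

  -- Both steps of the descent are primitive Pythagorean triples:
  -- (x², y², z) = (m² − n², 2mn, m² + n²) and (x, n, m) = (r² − s², 2rs, r² + s²);
  -- then (y/2)² = r s m with r, s, m pairwise coprime, so r = u², s = v², m = w².
  quartic-descent : ∀ {x y z} → Coprime x y → 2 ∣ y → y ≢ 0 →
                    x * x * (x * x) + y * y * (y * y) ≡ z * z →
                    ∃[ u ] ∃[ v ] ∃[ w ] u ≢ 0 × v ≢ 0 × Coprime u v × w < z ×
                      u * u * (u * u) + v * v * (v * v) ≡ w * w
  quartic-descent {x} {y} {z} cxy 2∣y y≢0 eq
    with pythagorean-parametrisation {x * x} {y * y} {z} (coprime-*² cxy) (∣m⇒∣m*n y 2∣y) eq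
  ... | m , n , cmn , xx+nn≡mm , yy≡2mn , refl
    with pythagorean-parametrisation {x} {n} {m} cxn 2∣n xx+nn≡mm
    where
    cxn : Coprime x n
    cxn {d} (d∣x , d∣n) = coprime-*²ʳ (coprime-sym cmn)
      (d∣n , subst (d ∣_) xx+nn≡mm (∣m∣n⇒∣m+n (∣m⇒∣m*n x d∣x) (∣m⇒∣m*n n d∣n)))
    2∣n : 2 ∣ n
    2∣n = decidable-stable (2 ∣? n)
      (λ 2∤n → odd²+odd²≢² {c = m} (coprime⇒¬both-even cxy 2∣y) 2∤n xx+nn≡mm)
  ... | r , s , crs , _ , refl , refl with 2∣y
  ... | divides y′ refl
    with coprime-factor-square {r} {s * (r * r + s * s)} {y′} cr[sm] rsm≡y′y′
       | coprime-factor-square {s * (r * r + s * s)} {r} {y′} (coprime-sym cr[sm])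
                              (trans (*-comm (s * _) r) rsm≡y′y′)
    where
    cr[sm] : Coprime r (s * (r * r + s * s))
    cr[sm] = coprime-*ʳ crs (coprime-+*² crs)
    rsm≡y′y′ : r * (s * (r * r + s * s)) ≡ y′ * y′
    rsm≡y′y′ = *-cancelˡ-≡ _ _ 4 (begin
      4 * (r * (s * (r * r + s * s)))       ≡⟨ solve (r ∷ s ∷ []) ⟩
      2 * ((r * r + s * s) * (2 * (r * s))) ≡⟨ yy≡2mn ⟨
      y′ * 2 * (y′ * 2)                     ≡⟨ solve (y′ ∷ []) ⟩
      4 * (y′ * y′)                         ∎)
  ... | u , refl | t , sm≡tt
    with coprime-factor-square {s} {u * u * (u * u) + s * s} {t} csm sm≡tt
       | coprime-factor-square {u * u * (u * u) + s * s} {s} {t} (coprime-sym csm)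
                              (trans (*-comm _ s) sm≡tt)
    where
    csm : Coprime s (u * u * (u * u) + s * s)
    csm = subst (Coprime s) (+-comm (s * s) _) (coprime-+*² (coprime-sym crs))
  ... | v , refl | w , m≡ww = u , v , w , u≢0 , v≢0 , coprime-*²⇒coprime crs , w<z , m≡ww
    where
    n≢0 : n ≢ 0
    n≢0 n≡0 = y≢0 (*²≡0⇒≡0 (trans yy≡2mn
      (trans (cong (λ k → 2 * (m * k)) n≡0) (cong (2 *_) (*-zeroʳ m)))))
    u≢0 : u ≢ 0
    u≢0 refl = n≢0 refl
    v≢0 : v ≢ 0
    v≢0 refl = n≢0 (cong (2 *_) (*-zeroʳ (u * u)))
    w<z : w < m * m + n * n
    w<z = ≤-<-trans (≤-trans (n≤n*n w) (≤-trans (≤-reflexive (sym m≡ww)) (n≤n*n m)))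
                    (m<m+n (m * m) (*-mono-< (n≢0⇒n>0 n≢0) (n≢0⇒n>0 n≢0)))

  x⁴+y⁴≡z²⇒x≡0⊎y≡0 : ∀ {x y z} → Coprime x y →
                      x * x * (x * x) + y * y * (y * y) ≡ z * z → x ≡ 0 ⊎ y ≡ 0
  x⁴+y⁴≡z²⇒x≡0⊎y≡0 {x} {y} {z} = <-rec Goal step z {x} {y}
    where
    Goal : ℕ → Set
    Goal z = ∀ {x y} → Coprime x y → x * x * (x * x) + y * y * (y * y) ≡ z * z → x ≡ 0 ⊎ y ≡ 0
    no-even-solution : ∀ {z} → (∀ {w} → w < z → Goal w) →
                       ∀ {x y} → Coprime x y → 2 ∣ y → y ≢ 0 →
                       ¬ (x * x * (x * x) + y * y * (y * y) ≡ z * z)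
    no-even-solution rec cxy 2∣y y≢0 eq with quartic-descent cxy 2∣y y≢0 eq
    ... | u , v , w , u≢0 , v≢0 , cuv , w<z , eq′ with rec w<z cuv eq′
    ...   | inj₁ u≡0 = u≢0 u≡0
    ...   | inj₂ v≡0 = v≢0 v≡0
    step : ∀ z → (∀ {w} → w < z → Goal w) → Goal z
    step z rec {0} _ _ = inj₁ refl
    step z rec {suc _} {0} _ _ = inj₂ refl
    step z rec {x@(suc _)} {y@(suc _)} cxy eq with 2 ∣? x | 2 ∣? y
    ... | _       | yes 2∣y = contradiction eq (no-even-solution rec cxy 2∣y (λ ()))
    ... | yes 2∣x | no _    = contradiction (trans (+-comm (y * y * (y * y)) (x * x * (x * x))) eq)
                                            (no-even-solution rec (coprime-sym cxy) 2∣x (λ ()))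
    ... | no 2∤x  | no 2∤y  = contradiction eq (odd²+odd²≢² {c = z} (2∤x ∘ 2∣²⇒2∣) (2∤y ∘ 2∣²⇒2∣))

module RationalQuartics where
  open import Data.Rational
  open import Data.Rational.Literals using (fromℤ)
  open import Data.Rational.Properties
  open import Data.Rational.Unnormalised using (*≡*)
  import Data.Rational.Unnormalised.Properties as ℚᵘ
  open import Data.Integer as ℤ using (ℤ; +_; -[1+_])
  import Data.Integer.Properties as ℤ
  import Data.Nat as ℕ
  import Data.Nat.Properties as ℕ
  open import Data.Nat.Divisibility using (divides; ∣1⇒≡1)
  open import Data.Nat.Coprimality using (coprime-divisor; recompute) renaming (sym to coprime-sym)
  open import Data.Product using (∃-syntax; _,_; proj₁; proj₂)
  open import Data.Sum using (_⊎_; inj₁; inj₂; [_,_]′)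
  open import Relation.Binary.PropositionalEquality
  open import Relation.Nullary using (contradiction; yes; no)
  open ≡-Reasoning
  open import Data.Rational.Solver using (module +-*-Solver)
  open +-*-Solver using (solve; con; _:+_; _:*_; :-_; _:-_; _:=_)
  open NatSquares using (coprime-*²)
  open FermatQuartic using (x⁴+y⁴≡z²⇒x≡0⊎y≡0)

  p*q≡0⇒p≡0⊎q≡0 : ∀ p q → p * q ≡ 0ℚ → p ≡ 0ℚ ⊎ q ≡ 0ℚ
  p*q≡0⇒p≡0⊎q≡0 p q pq≡0 with q ≟ 0ℚ
  ... | yes q≡0 = inj₂ q≡0
  ... | no q≢0 = inj₁ (begin
    p              ≡⟨ *-identityʳ p ⟨
    p * 1ℚ         ≡⟨ cong (p *_) (*-inverseʳ q) ⟨
    p * (q * 1/ q) ≡⟨ *-assoc p q (1/ q) ⟨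
    p * q * 1/ q   ≡⟨ cong (_* 1/ q) pq≡0 ⟩
    0ℚ * 1/ q      ≡⟨ *-zeroˡ (1/ q) ⟩
    0ℚ             ∎)
    where instance _ = ≢-nonZero q≢0

  p*p-nonNeg : ∀ p → NonNegative (p * p)
  p*p-nonNeg p@(mkℚ (+ _) _ _) = nonNeg*nonNeg⇒nonNeg p p
  p*p-nonNeg p@(mkℚ -[1+ _ ] _ _) = nonPos*nonPos⇒nonPos p p

  -- 4 (x² − x + 1) = (2x − 1)² + 3
  x²-x+1≢0 : ∀ x → x * x - x + 1ℚ ≢ 0ℚ
  x²-x+1≢0 x eq = <-irrefl (sym sum≡0) (positive⁻¹ sum {{sum-pos}})
    where
    sum : ℚ
    sum = (x + x - 1ℚ) * (x + x - 1ℚ) + (1ℚ + 1ℚ + 1ℚ)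
    sum-pos : Positive sum
    sum-pos = nonNeg+pos⇒pos ((x + x - 1ℚ) * (x + x - 1ℚ)) {{p*p-nonNeg (x + x - 1ℚ)}}
                             (1ℚ + 1ℚ + 1ℚ)
    sum≡0 : sum ≡ 0ℚ
    sum≡0 = begin
      (x + x - 1ℚ) * (x + x - 1ℚ) + (1ℚ + 1ℚ + 1ℚ)
        ≡⟨ solve 1 (λ x → (x :+ x :- con 1ℚ) :* (x :+ x :- con 1ℚ) :+ (con 1ℚ :+ con 1ℚ :+ con 1ℚ)
                       := (x :* x :- x :+ con 1ℚ) :* (con 1ℚ :+ con 1ℚ :+ con 1ℚ :+ con 1ℚ)) refl x ⟩
      (x * x - x + 1ℚ) * (1ℚ + 1ℚ + 1ℚ + 1ℚ)
        ≡⟨ cong (_* (1ℚ + 1ℚ + 1ℚ + 1ℚ)) eq ⟩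
      0ℚ * (1ℚ + 1ℚ + 1ℚ + 1ℚ)
        ≡⟨ *-zeroˡ (1ℚ + 1ℚ + 1ℚ + 1ℚ) ⟩
      0ℚ ∎

  fromℤ-+ : ∀ i j → fromℤ (i ℤ.+ j) ≡ fromℤ i + fromℤ j
  fromℤ-+ i j = toℚᵘ-injective (ℚᵘ.≃-trans
    (*≡* (cong (ℤ._* + 1) (sym (cong₂ ℤ._+_ (ℤ.*-identityʳ i) (ℤ.*-identityʳ j)))))
    (ℚᵘ.≃-sym (toℚᵘ-homo-+ (fromℤ i) (fromℤ j))))

  fromℤ-* : ∀ i j → fromℤ (i ℤ.* j) ≡ fromℤ i * fromℤ j
  fromℤ-* i j = toℚᵘ-injective (ℚᵘ.≃-sym (toℚᵘ-homo-* (fromℤ i) (fromℤ j)))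

  fromℤ-+ℕ : ∀ m n → fromℤ (+ (m ℕ.+ n)) ≡ fromℤ (+ m) + fromℤ (+ n)
  fromℤ-+ℕ m n = trans (cong fromℤ (ℤ.pos-+ m n)) (fromℤ-+ (+ m) (+ n))

  fromℤ-*ℕ : ∀ m n → fromℤ (+ (m ℕ.* n)) ≡ fromℤ (+ m) * fromℤ (+ n)
  fromℤ-*ℕ m n = trans (cong fromℤ (ℤ.pos-* m n)) (fromℤ-* (+ m) (+ n))

  fromℤ-⁴ℕ : ∀ m → fromℤ (+ (m ℕ.* m ℕ.* (m ℕ.* m))) ≡
                   fromℤ (+ m) * fromℤ (+ m) * (fromℤ (+ m) * fromℤ (+ m))
  fromℤ-⁴ℕ m = trans (fromℤ-*ℕ (m ℕ.* m) (m ℕ.* m))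
                     (cong₂ _*_ (fromℤ-*ℕ m m) (fromℤ-*ℕ m m))

  p*↧p≡↥p : ∀ p → p * fromℤ (↧ p) ≡ fromℤ (↥ p)
  p*↧p≡↥p p@(mkℚ n d-1 _) = toℚᵘ-injective (ℚᵘ.≃-trans (toℚᵘ-homo-* p (fromℤ (↧ p)))
    (*≡* (trans (ℤ.*-identityʳ _) (cong (λ m → n ℤ.* + m) (sym (ℕ.*-identityʳ (ℕ.suc d-1)))))))

  -- c² = N d² with c ⊥ d forces d = 1.
  p*p≡N⇒N-square : ∀ p N → p * p ≡ fromℤ (+ N) → ∃[ k ] k ℕ.* k ≡ N
  p*p≡N⇒N-square p@(mkℚ c d-1 c⊥d) N eq
    with ℚᵘ.≃-trans (ℚᵘ.≃-sym (toℚᵘ-homo-* p p)) (toℚᵘ-cong eq)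
  ... | *≡* cc≡Ndd = C , (begin
    C ℕ.* C            ≡⟨ cc≡Ndd′ ⟩
    N ℕ.* (D ℕ.* D)    ≡⟨ cong (N ℕ.*_) DD≡1 ⟩
    N ℕ.* 1            ≡⟨ ℕ.*-identityʳ N ⟩
    N                  ∎)
    where
    C D : ℕ.ℕ
    C = ℤ.∣ c ∣
    D = ℕ.suc d-1
    cc≡Ndd′ : C ℕ.* C ≡ N ℕ.* (D ℕ.* D)
    cc≡Ndd′ = begin
      C ℕ.* C                          ≡⟨ ℕ.*-identityʳ (C ℕ.* C) ⟨
      C ℕ.* C ℕ.* 1                    ≡⟨ cong (ℕ._* 1) (ℤ.abs-* c c) ⟨
      ℤ.∣ c ℤ.* c ∣ ℕ.* 1              ≡⟨ ℤ.abs-* (c ℤ.* c) (+ 1) ⟨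
      ℤ.∣ c ℤ.* c ℤ.* + 1 ∣            ≡⟨ cong ℤ.∣_∣ cc≡Ndd ⟩
      ℤ.∣ + N ℤ.* + (D ℕ.* D) ∣        ≡⟨ ℤ.abs-* (+ N) (+ (D ℕ.* D)) ⟩
      N ℕ.* (D ℕ.* D)                  ∎
    DD≡1 : D ℕ.* D ≡ 1
    DD≡1 = ∣1⇒≡1 (coprime-divisor (coprime-*² (coprime-sym (recompute c⊥d)))
                                  (divides N (trans (ℕ.*-identityʳ (C ℕ.* C)) cc≡Ndd′)))

  k*k≢2 : ∀ k → k ℕ.* k ≢ 2
  k*k≢2 0 ()
  k*k≢2 1 ()
  k*k≢2 (ℕ.suc (ℕ.suc k)) kk≡2 with subst (4 ℕ.≤_) kk≡2 (ℕ.*-mono-≤ 2≤2+k 2≤2+k)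
    where
    2≤2+k : 2 ℕ.≤ 2 ℕ.+ k
    2≤2+k = ℕ.s≤s (ℕ.s≤s ℕ.z≤n)
  ... | ℕ.s≤s (ℕ.s≤s ())

  √2-irrational : ∀ p → p * p ≢ 1ℚ + 1ℚ
  √2-irrational p pp≡2 with p*p≡N⇒N-square p 2 pp≡2
  ... | k , kk≡2 = k*k≢2 k kk≡2

  ∣p∣*∣p∣≡p*p : ∀ p → ∣ p ∣ * ∣ p ∣ ≡ p * p
  ∣p∣*∣p∣≡p*p p with ∣p∣≡p∨∣p∣≡-p p
  ... | inj₁ ∣p∣≡p  = cong₂ _*_ ∣p∣≡p ∣p∣≡p
  ... | inj₂ ∣p∣≡-p = trans (cong₂ _*_ ∣p∣≡-p ∣p∣≡-p)
                            (solve 1 (λ p → (:- p) :* (:- p) := p :* p) refl p)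

  quartic-homogeneous : ∀ u v w i → w * w ≡ u * u * (u * u) + v * v * (v * v) →
    w * i * i * (w * i * i) ≡ u * i * (u * i) * (u * i * (u * i)) + v * i * (v * i) * (v * i * (v * i))
  quartic-homogeneous u v w i eq = begin
    w * i * i * (w * i * i)
      ≡⟨ solve 2 (λ w i → w :* i :* i :* (w :* i :* i) := w :* w :* (i :* i :* (i :* i))) refl w i ⟩
    w * w * (i * i * (i * i))
      ≡⟨ cong (_* (i * i * (i * i))) eq ⟩
    (u * u * (u * u) + v * v * (v * v)) * (i * i * (i * i))
      ≡⟨ solve 3 (λ u v i → (u :* u :* (u :* u) :+ v :* v :* (v :* v)) :* (i :* i :* (i :* i))
                         := u :* i :* (u :* i) :* (u :* i :* (u :* i)) :+ v :* i :* (v :* i) :* (v :* i :* (v :* i)))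
                refl u v i ⟩
    u * i * (u * i) * (u * i * (u * i)) + v * i * (v * i) * (v * i * (v * i)) ∎

  -- For x = p / d in lowest terms: (w d²)² = ∣p∣⁴ + d⁴, a square of naturals.
  clear-denominator : ∀ x w → w * w ≡ x * x * (x * x) + 1ℚ →
    let P = ℤ.∣ ↥ x ∣ ; D = ↧ₙ x ; Q = fromℤ (↧ x) in
    w * Q * Q * (w * Q * Q) ≡ fromℤ (+ (P ℕ.* P ℕ.* (P ℕ.* P) ℕ.+ D ℕ.* D ℕ.* (D ℕ.* D)))
  clear-denominator x@record{} w eq = begin
      w * Q * Q * (w * Q * Q)
        ≡⟨ quartic-homogeneous ∣ x ∣ 1ℚ w Q (trans eq (sym (cong (λ y → y * y + 1ℚ) (∣p∣*∣p∣≡p*p x)))) ⟩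
      ∣ x ∣ * Q * (∣ x ∣ * Q) * (∣ x ∣ * Q * (∣ x ∣ * Q)) + 1ℚ * Q * (1ℚ * Q) * (1ℚ * Q * (1ℚ * Q))
        ≡⟨ cong (λ y → ∣ x ∣ * Q * (∣ x ∣ * Q) * (∣ x ∣ * Q * (∣ x ∣ * Q)) + y * y * (y * y)) (*-identityˡ Q) ⟩
      ∣ x ∣ * Q * (∣ x ∣ * Q) * (∣ x ∣ * Q * (∣ x ∣ * Q)) + Q * Q * (Q * Q)
        ≡⟨ cong (λ y → y * y * (y * y) + Q * Q * (Q * Q)) (p*↧p≡↥p ∣ x ∣) ⟩
      fromℤ (+ P) * fromℤ (+ P) * (fromℤ (+ P) * fromℤ (+ P)) + Q * Q * (Q * Q)
        ≡⟨ cong₂ _+_ (fromℤ-⁴ℕ P) (fromℤ-⁴ℕ D) ⟨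
      fromℤ (+ (P ℕ.* P ℕ.* (P ℕ.* P))) + fromℤ (+ (D ℕ.* D ℕ.* (D ℕ.* D)))
        ≡⟨ fromℤ-+ℕ (P ℕ.* P ℕ.* (P ℕ.* P)) (D ℕ.* D ℕ.* (D ℕ.* D)) ⟨
      fromℤ (+ (P ℕ.* P ℕ.* (P ℕ.* P) ℕ.+ D ℕ.* D ℕ.* (D ℕ.* D))) ∎
    where
    P D : ℕ.ℕ
    P = ℤ.∣ ↥ x ∣
    D = ↧ₙ x
    Q : ℚ
    Q = fromℤ (↧ x)

  w²≡x⁴+1⇒x≡0 : ∀ x w → w * w ≡ x * x * (x * x) + 1ℚ → x ≡ 0ℚ
  w²≡x⁴+1⇒x≡0 x@(mkℚ n _ n⊥d) w eq =
    [ (λ P≡0 → ↥p≡0⇒p≡0 x (ℤ.∣i∣≡0⇒i≡0 P≡0)) , (λ ()) ]′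
      (x⁴+y⁴≡z²⇒x≡0⊎y≡0 {z = proj₁ square} (recompute n⊥d) (sym (proj₂ square)))
    where
    P D : ℕ.ℕ
    P = ℤ.∣ n ∣
    D = ↧ₙ x
    square : ∃[ k ] k ℕ.* k ≡ P ℕ.* P ℕ.* (P ℕ.* P) ℕ.+ D ℕ.* D ℕ.* (D ℕ.* D)
    square = p*p≡N⇒N-square (w * fromℤ (↧ x) * fromℤ (↧ x)) _ (clear-denominator x w eq)

  w²≡u⁴+v⁴⇒u≡0 : ∀ u v w → v ≢ 0ℚ →
                 w * w ≡ u * u * (u * u) + v * v * (v * v) → u ≡ 0ℚ
  w²≡u⁴+v⁴⇒u≡0 u v w v≢0 eq =
    [ (λ u≡0 → u≡0) , (λ 1/v≡0 → contradiction 1/v≡0 1/v≢0) ]′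
      (p*q≡0⇒p≡0⊎q≡0 u (1/ v) u/v≡0)
    where
    instance _ = ≢-nonZero v≢0
    1/v≢0 : 1/ v ≢ 0ℚ
    1/v≢0 1/v≡0 = 1≢0 (trans (sym (*-inverseʳ v)) (trans (cong (v *_) 1/v≡0) (*-zeroʳ v)))
    u/v≡0 : u * 1/ v ≡ 0ℚ
    u/v≡0 = w²≡x⁴+1⇒x≡0 (u * 1/ v) (w * 1/ v * 1/ v)
      (trans (quartic-homogeneous u v w (1/ v) eq)
             (cong (λ y → u * 1/ v * (u * 1/ v) * (u * 1/ v * (u * 1/ v)) + y * y * (y * y)) (*-inverseʳ v)))

  w²≡t²[x⁴+1]⇒x≡0 : ∀ x t w → t ≢ 0ℚ → w * w ≡ t * t * (x * x * (x * x) + 1ℚ) → x ≡ 0ℚ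
  w²≡t²[x⁴+1]⇒x≡0 x t w t≢0 eq =
    [ (λ x≡0 → x≡0) , (λ t≡0 → contradiction t≡0 t≢0) ]′
      (p*q≡0⇒p≡0⊎q≡0 x t (w²≡u⁴+v⁴⇒u≡0 (x * t) t (w * t) t≢0 (begin
        w * t * (w * t)
          ≡⟨ solve 2 (λ w t → w :* t :* (w :* t) := w :* w :* (t :* t)) refl w t ⟩
        w * w * (t * t)
          ≡⟨ cong (_* (t * t)) eq ⟩
        t * t * (x * x * (x * x) + 1ℚ) * (t * t)
          ≡⟨ solve 2 (λ x t → t :* t :* (x :* x :* (x :* x) :+ con 1ℚ) :* (t :* t)
                           := x :* t :* (x :* t) :* (x :* t :* (x :* t)) :+ t :* t :* (t :* t)) refl x t ⟩
        x * t * (x * t) * (x * t * (x * t)) + t * t * (t * t) ∎)))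

module QuadraticField where
  open import Defs renaming (_+_√2 to _+√2·_)
  open import Data.Nat using (ℕ)
  open import Data.Rational using (ℚ; 0ℚ; 1ℚ; _+_; _*_; _-_)
  open import Data.Rational.Solver using (module +-*-Solver)
  open +-*-Solver using (Polynomial; solve; con; _:+_; _:*_; :-_; _:-_; _:=_)
  open import Relation.Binary.PropositionalEquality

  norm : ℚ√2 → ℚ
  norm (a +√2· b) = a * a - (b * b + b * b)

  -- ℚ(√2) arithmetic on solver expressions, mirroring Defs clause by clause, so that
  -- identities between components are decided by the ring solver for ℚ.
  record Expr√2 (n : ℕ) : Set where
    constructor _⊹_
    field
      reᴱ irᴱ : Polynomial n
  open Expr√2

  infixl 6 _⊕ᴱ_ _⊖ᴱ_
  infixl 7 _⊛ᴱ_

  _⊕ᴱ_ : ∀ {n} → Expr√2 n → Expr√2 n → Expr√2 n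
  (a ⊹ b) ⊕ᴱ (c ⊹ d) = (a :+ c) ⊹ (b :+ d)

  ⊝ᴱ_ : ∀ {n} → Expr√2 n → Expr√2 n
  ⊝ᴱ (a ⊹ b) = (:- a) ⊹ (:- b)

  _⊖ᴱ_ : ∀ {n} → Expr√2 n → Expr√2 n → Expr√2 n
  x ⊖ᴱ y = x ⊕ᴱ (⊝ᴱ y)

  _⊛ᴱ_ : ∀ {n} → Expr√2 n → Expr√2 n → Expr√2 n
  (a ⊹ b) ⊛ᴱ (c ⊹ d) = ((a :* c) :+ ((b :* d) :+ (b :* d))) ⊹ ((a :* d) :+ (b :* c))

  ιᴱ : ∀ {n} → Polynomial n → Expr√2 n
  ιᴱ q = q ⊹ con 0ℚ

  oneᴱ twoᴱ √2ᴱ : ∀ {n} → Expr√2 n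
  oneᴱ = ιᴱ (con 1ℚ)
  twoᴱ = oneᴱ ⊕ᴱ oneᴱ
  √2ᴱ = con 0ℚ ⊹ con 1ℚ

  curveLHSᴱ : ∀ {n} → Expr√2 n → Expr√2 n
  curveLHSᴱ X =
    (X ⊛ᴱ X ⊛ᴱ X ⊛ᴱ X)
    ⊖ᴱ ((oneᴱ ⊕ᴱ √2ᴱ) ⊛ᴱ (X ⊛ᴱ X ⊛ᴱ X))
    ⊕ᴱ ((twoᴱ ⊕ᴱ √2ᴱ) ⊛ᴱ (X ⊛ᴱ X))
    ⊖ᴱ ((oneᴱ ⊕ᴱ √2ᴱ) ⊛ᴱ X)
    ⊕ᴱ oneᴱ

  normᴱ : ∀ {n} → Expr√2 n → Polynomial n
  normᴱ (a ⊹ b) = a :* a :- (b :* b :+ b :* b)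

  norm-⊛ : ∀ x y → norm (x ⊛ y) ≡ norm x * norm y
  norm-⊛ (a +√2· b) (c +√2· d) =
    solve 4 (λ a b c d → normᴱ ((a ⊹ b) ⊛ᴱ (c ⊹ d)) := normᴱ (a ⊹ b) :* normᴱ (c ⊹ d))
          refl a b c d

  norm-curveLHS : ∀ X → norm (curveLHS (ι X)) ≡
                        (X * X - X + 1ℚ) * (X * X - X + 1ℚ) * (X * X * (X * X) + 1ℚ)
  norm-curveLHS = solve 1 (λ X → normᴱ (curveLHSᴱ (ιᴱ X)) :=
    (X :* X :- X :+ con 1ℚ) :* (X :* X :- X :+ con 1ℚ) :* (X :* X :* (X :* X) :+ con 1ℚ)) refl

  norm-x²-√2xy+y² : ∀ x y → norm ((ι x ⊛ ι x) ⊖ (√2 ⊛ ι x ⊛ ι y) ⊕ (ι y ⊛ ι y)) ≡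
                            x * x * (x * x) + y * y * (y * y)
  norm-x²-√2xy+y² = solve 2 (λ x y → normᴱ ((ιᴱ x ⊛ᴱ ιᴱ x) ⊖ᴱ (√2ᴱ ⊛ᴱ ιᴱ x ⊛ᴱ ιᴱ y) ⊕ᴱ (ιᴱ y ⊛ᴱ ιᴱ y)) :=
    x :* x :* (x :* x) :+ y :* y :* (y :* y)) refl

module RationalPoints where
  open import Defs renaming (_+_√2 to _+√2·_)
  open import Data.Rational using (0ℚ; 1ℚ; ↥_; _+_; _*_; _-_; _/_)
  open import Data.Rational.Properties using (+-0-group; p≡0⇒↥p≡0; fromℚᵘ-toℚᵘ)
  open import Data.Rational.Literals using (fromℤ)
  open import Algebra.Properties.Group +-0-group using (x∙y⁻¹≈ε⇒x≈y; inverseˡ-unique)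
  open import Data.Integer as ℤ using (+_)
  import Data.Integer.Properties as ℤ
  open import Data.Product using (_×_; _,_)
  open import Data.Sum using (_⊎_; inj₁; inj₂; [_,_]′)
  open import Relation.Binary.PropositionalEquality
  open import Relation.Nullary using (contradiction)
  open ≡-Reasoning
  open import Data.Rational.Solver using (module +-*-Solver)
  open +-*-Solver using (solve; con; _:+_; _:*_; _:-_; _:=_)
  open RationalQuartics
  open QuadraticField

  onCurve⇒X≡0 : ∀ X Y → OnCurve X Y → X ≡ 0ℚ
  onCurve⇒X≡0 X Y onCurve = w²≡t²[x⁴+1]⇒x≡0 X (X * X - X + 1ℚ) (norm Y) (x²-x+1≢0 X) (begin
    norm Y * norm Y             ≡⟨ norm-⊛ Y Y ⟨
    norm (Y ⊛ Y)                ≡⟨ cong norm onCurve ⟨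
    norm (curveLHS (ι X))       ≡⟨ norm-curveLHS X ⟩
    (X * X - X + 1ℚ) * (X * X - X + 1ℚ) * (X * X * (X * X) + 1ℚ) ∎)

  square≡one⇒±one : ∀ Y → Y ⊛ Y ≡ one → Y ≡ one ⊎ Y ≡ ⊝ one
  square≡one⇒±one (a +√2· b) YY≡1 =
    [ (λ a≡0 → contradiction (2b²≡2 a≡0) (√2-irrational (b + b))) , ±one ]′
      (p*q≡0⇒p≡0⊎q≡0 a b ab≡0)
    where
    re≡1 : a * a + (b * b + b * b) ≡ 1ℚ
    re≡1 = cong re YY≡1
    ab≡0 : a * b ≡ 0ℚ
    ab≡0 = [ (λ ab≡0 → ab≡0) , (λ 2≡0 → contradiction 2≡0 λ ()) ]′
      (p*q≡0⇒p≡0⊎q≡0 (a * b) (1ℚ + 1ℚ) (begin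
        a * b * (1ℚ + 1ℚ) ≡⟨ solve 2 (λ a b → a :* b :* (con 1ℚ :+ con 1ℚ) := a :* b :+ b :* a) refl a b ⟩
        a * b + b * a     ≡⟨ cong ir YY≡1 ⟩
        0ℚ                ∎))
    2b²≡2 : a ≡ 0ℚ → (b + b) * (b + b) ≡ 1ℚ + 1ℚ
    2b²≡2 a≡0 = begin
      (b + b) * (b + b)
        ≡⟨ solve 2 (λ a b → (b :+ b) :* (b :+ b)
                     := (a :* a :+ (b :* b :+ b :* b)) :* (con 1ℚ :+ con 1ℚ) :- a :* a :* (con 1ℚ :+ con 1ℚ)) refl a b ⟩
      (a * a + (b * b + b * b)) * (1ℚ + 1ℚ) - a * a * (1ℚ + 1ℚ)
        ≡⟨ cong₂ (λ r s → r * (1ℚ + 1ℚ) - s * s * (1ℚ + 1ℚ)) re≡1 a≡0 ⟩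
      1ℚ * (1ℚ + 1ℚ) - 0ℚ * 0ℚ * (1ℚ + 1ℚ)
        ≡⟨⟩
      1ℚ + 1ℚ ∎
    ±one : b ≡ 0ℚ → a +√2· b ≡ one ⊎ a +√2· b ≡ ⊝ one
    ±one b≡0 = [ (λ a-1≡0 → inj₁ (cong₂ _+√2·_ (x∙y⁻¹≈ε⇒x≈y a 1ℚ a-1≡0) b≡0))
               , (λ a+1≡0 → inj₂ (cong₂ _+√2·_ (inverseˡ-unique a 1ℚ a+1≡0) b≡0)) ]′
               (p*q≡0⇒p≡0⊎q≡0 (a - 1ℚ) (a + 1ℚ) (begin
      (a - 1ℚ) * (a + 1ℚ)
        ≡⟨ solve 2 (λ a b → (a :- con 1ℚ) :* (a :+ con 1ℚ)
                         := a :* a :+ (b :* b :+ b :* b) :- con 1ℚ :- (b :* b :+ b :* b)) refl a b ⟩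
      a * a + (b * b + b * b) - 1ℚ - (b * b + b * b)
        ≡⟨ cong₂ (λ r s → r - 1ℚ - (s * s + s * s)) re≡1 b≡0 ⟩
      1ℚ - 1ℚ - (0ℚ * 0ℚ + 0ℚ * 0ℚ)
        ≡⟨⟩
      0ℚ ∎))

  x²-√2xy+y²-square⇒x≡0 : ∀ x y → y ≢ 0ℚ →
                          HasSqrtIn ((ι x ⊛ ι x) ⊖ (√2 ⊛ ι x ⊛ ι y) ⊕ (ι y ⊛ ι y)) → x ≡ 0ℚ
  x²-√2xy+y²-square⇒x≡0 x y y≢0 (z , zz≡A) = w²≡u⁴+v⁴⇒u≡0 x y (norm z) y≢0 (begin
    norm z * norm z ≡⟨ norm-⊛ z z ⟨
    norm (z ⊛ z)    ≡⟨ cong norm zz≡A ⟩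
    norm ((ι x ⊛ ι x) ⊖ (√2 ⊛ ι x ⊛ ι y) ⊕ (ι y ⊛ ι y)) ≡⟨ norm-x²-√2xy+y² x y ⟩
    x * x * (x * x) + y * y * (y * y) ∎)

  i>0⇒i/1≢0 : ∀ i → i ℤ.> + 0 → i / 1 ≢ 0ℚ
  i>0⇒i/1≢0 i i>0 i/1≡0 = ℤ.<⇒≢ i>0 (begin
    + 0       ≡⟨ p≡0⇒↥p≡0 (i / 1) i/1≡0 ⟨
    ↥ (i / 1) ≡⟨ cong ↥_ (fromℚᵘ-toℚᵘ (fromℤ i)) ⟩
    i         ∎)

  rational-points : ∀ X Y → OnCurve X Y → X ≡ 0ℚ × (Y ≡ one ⊎ Y ≡ ⊝ one)
  -- curveLHS (ι 0ℚ) computes to one.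
  rational-points X Y onCurve = X≡0 , square≡one⇒±one Y (sym (subst (λ X → OnCurve X Y) X≡0 onCurve))
    where
    X≡0 : X ≡ 0ℚ
    X≡0 = onCurve⇒X≡0 X Y onCurve

mainTheorem5 :
    ((X : ℚ) (Y : ℚ√2) → OnCurve X Y → (X ≡ 0ℚ) × ((Y ≡ one) ⊎ (Y ≡ ⊝ one)))
    × (OnCurve 0ℚ one × OnCurve 0ℚ (⊝ one))
    × ((x y : ℤ) → x > + 0 → y > + 0 →
        ¬ (HasSqrtIn ((ιℤ x ⊛ ιℤ x) ⊖ (√2 ⊛ ιℤ x ⊛ ιℤ y) ⊕ (ιℤ y ⊛ ιℤ y))
           × HasSqrtIn ((ιℤ x ⊛ ιℤ x) ⊖ (ιℤ x ⊛ ιℤ y) ⊕ (ιℤ y ⊛ ιℤ y))))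
mainTheorem5 =
  rational-points ,
  (refl , refl) ,
  λ x y x>0 y>0 (root , _) →
    i>0⇒i/1≢0 x x>0 (x²-√2xy+y²-square⇒x≡0 (x / 1) (y / 1) (i>0⇒i/1≢0 y y>0) root)
  where open RationalPoints
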